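{- Let $\mathcal{F}$ be a union-closed family of finite sets with $\emptyset\in\mathcal{F}$, let $U\subseteq\bigcup\mathcal{F}$, and let $\mathcal{F}'$ be an extension of $(\mathcal{F},U)$. Then $\mathcal{F}'$ is also an extension of $(\mathcal{N}^3_{\mathcal{F}}(U),U)$ and $$\mu_{\mathcal{F},\mathcal{F}'}(U)=\mu_{\mathcal{N}^3_{\mathcal{F}}(U),\mathcal{F}'}(U).$$
   Context: For families $\mathcal{A},\mathcal{B}$ of sets, $\mathcal{A}\vee\mathcal{B}=\{A\cup B: A\in\mathcal{A},B\in\mathcal{B}\}$, and for a set $Z$, $\mathcal{A}_{\setminus Z}=\{A\setminus Z:A\in\mathcal{A}\}$. For a union-closed family $\mathcal{K}$ with $\emptyset\in\mathcal{K}$: $J(\mathcal{K})$ is the set of union generators (nonempty $V\in\mathcal{K}$ not equal to the union of the members of $\mathcal{K}$ properly contained in $V$); $\pi_{\mathcal{K}}(X)=\bigcup\{V\in\mathcal{K}:V\subseteq X\}$. For a set $W$, $\mathcal{N}_{\mathcal{F}}(W)$ is the family of all unions of subfamilies of $\{V\in J(\mathcal{F}):V\cap W\neq\emptyset\}$ (empty union $=\emptyset$), and $\mathcal{N}^3_{\mathcal{F}}(U)=\mathcal{N}_{\mathcal{F}}(\bigcup\mathcal{N}_{\mathcal{F}}(U))$. A union-closed family $\mathcal{F}'$ is an extension of $(\mathcal{K},U)$ if $\mathcal{F}'=\mathcal{K}\vee\mathcal{H}$ for a nonempty union-closed family $\mathcal{H}$ with $(\bigcup\mathcal{H})\cap U=\emptyset$.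 For $X$ with $X\cap U=\emptyset$, $E_{\mathcal{K},U}(X)$ is the set of $Y\subseteq U$ with $\pi_{\mathcal{K}}(X\cup Y)\cap U=Y$ and $\pi_{\mathcal{K}}(X\cup Y)\supseteq\pi_{\mathcal{K}}(X\cup U)\setminus U$. For an extension $\mathcal{F}'$ of $(\mathcal{K},U)$, $\mu_{\mathcal{K},\mathcal{F}'}(U)=\sum_{X\in\mathcal{F}'_{\setminus U}}|E_{\mathcal{K},U}(X)|\,/\,|\mathcal{F}'_{\setminus U}|$. -}

module Defs where

open import Data.Bool using (Bool; true; false; _∧_; not)
open import Data.Bool.Properties using () renaming (_≟_ to _≟B_)
open import Data.Nat using (ℕ; zero; suc)
open import Data.Fin.Subset using (Subset; Side; inside; outside; ⊥; _∪_; _∩_; _─_)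
open import Data.Fin.Subset.Properties using (_⊆?_)
open import Data.Vec using ([]; _∷_)
open import Data.Vec.Properties using (≡-dec)
open import Data.List using (List; []; _∷_; _++_; map; foldr; length; filterᵇ)
open import Data.Bool.ListAction using (any)
open import Data.Nat.ListAction using (sum)
open import Data.Product using (Σ; ∃; _×_)
open import Data.Integer using (+_)
open import Data.Rational using (ℚ; 0ℚ; _/_)
open import Relation.Binary.PropositionalEquality using (_≡_)
open import Relation.Nullary using (Dec)
open import Relation.Nullary.Decidable using (⌊_⌋)

private variable n : ℕ

-- Ground set: Fin n.  Sets are Subset n; a family of sets is given by its
-- characteristic (Boolean) function on Subset n.

_≟ˢ_ : (A B : Subset n) → Dec (A ≡ B)
A ≟ˢ B = ≡-dec _≟B_ A B

_==_ : Subset n → Subset n → Bool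
A == B = ⌊ A ≟ˢ B ⌋

_⊆ᵇ_ : Subset n → Subset n → Bool
A ⊆ᵇ B = ⌊ A ⊆? B ⌋

-- enumeration of all subsets of Fin n (each exactly once)
subsets : (n : ℕ) → List (Subset n)
subsets zero    = [] ∷ []
subsets (suc n) = map (outside ∷_) (subsets n) ++ map (inside ∷_) (subsets n)

Family : ℕ → Set
Family n = Subset n → Bool

members : Family n → List (Subset n)
members {n} F = filterᵇ F (subsets n)

card : Family n → ℕ
card F = length (members F)

bigUnion : List (Subset n) → Subset n
bigUnion = foldr _∪_ ⊥

⋃ᶠ : Family n → Subset n
⋃ᶠ F = bigUnion (members F)

UnionClosed : Family n → Set
UnionClosed F = ∀ A B → F A ≡ true → F B ≡ true → F (A ∪ B) ≡ true

_∨ᶠ_ : Family n → Family n → Family n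
_∨ᶠ_ {n} K H X = any (λ A → any (λ B → K A ∧ (H B ∧ ((A ∪ B) == X))) (subsets n)) (subsets n)

restrict : Family n → Subset n → Family n
restrict {n} F Z Y = any (λ A → F A ∧ ((A ─ Z) == Y)) (subsets n)

J : Family n → Family n
J K V = K V ∧ (not (V == ⊥) ∧ not (V == ⋃ᶠ (λ W → K W ∧ ((W ⊆ᵇ V) ∧ not (W == V)))))

π : Family n → Subset n → Subset n
π K X = ⋃ᶠ (λ V → K V ∧ (V ⊆ᵇ X))

unionsOf : List (Subset n) → List (Subset n)
unionsOf []       = ⊥ ∷ []
unionsOf (V ∷ Vs) = unionsOf Vs ++ map (V ∪_) (unionsOf Vs)

𝓝 : Family n → Subset n → Family n
𝓝 F W X = any (_== X) (unionsOf (members (λ V → J F V ∧ not ((V ∩ W) == ⊥))))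

𝓝³ : Family n → Subset n → Family n
𝓝³ F U = 𝓝 F (⋃ᶠ (𝓝 F U))

IsExtension : Family n → Subset n → Family n → Set
IsExtension {n} K U F' =
  UnionClosed F' ×
  Σ (Family n) (λ H →
      (∃ λ X → H X ≡ true) × UnionClosed H × ((⋃ᶠ H ∩ U) ≡ ⊥) ×
      (∀ X → F' X ≡ (K ∨ᶠ H) X))

E : Family n → Subset n → Subset n → Family n
E K U X Y = (Y ⊆ᵇ U) ∧ (((π K (X ∪ Y) ∩ U) == Y) ∧ ((π K (X ∪ U) ─ U) ⊆ᵇ π K (X ∪ Y)))

-- a / b as a rational, with the convention a / 0 = 0 (never used for extensions)
ratio : ℕ → ℕ → ℚ
ratio a zero    = 0ℚ
ratio a (suc d) = (+ a) / suc d

μ : Family n → Family n → Subset n → ℚ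
μ K F' U = ratio (sum (map (λ X → card (E K U X)) (members (restrict F' U))))
                 (card (restrict F' U))

-- Every member of 𝓕 is the union of the generators of 𝓕 it contains (induction along ⊂).
-- Hence π_𝓕(S) is the union of the generators inside S, and π_{𝓝³}(S) the union of those
-- generators inside S that meet W = ⋃ 𝓝_𝓕(U).  A generator meeting U lies in W, so the two
-- projections agree on U and at every point of W, while a generator avoiding U that lies in
-- X ∪ U already lies in X ∪ Y.  Together these make the conditions defining E_{𝓕,U}(X) and
-- E_{𝓝³,U}(X) equivalent, so the averages μ coincide.  For the extension, if 𝓕' = 𝓕 ∨ 𝓗
-- then 𝓕' = 𝓝³ ∨ 𝓗' with 𝓗' = {Z ∈ 𝓕' : Z ∩ U = ∅}: each A ∈ 𝓕 is the union of its
-- generators meeting W, a member of 𝓝³, and of its members avoiding U, which are absorbed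
-- into the 𝓗-part.

module Submission where

open import Defs
open import Data.Nat using (ℕ)
open import Data.Bool using (Bool; true; false; _∧_; not; T)
open import Data.Bool.Properties using (T-≡; ⇔→≡)
open import Data.Bool.ListAction using (any)
open import Data.Fin using (Fin)
open import Data.Fin.Subset
  using (Subset; inside; outside; ⊥; _∪_; _∩_; _─_; _∈_; _∉_; _⊆_; _⊂_; Nonempty)
open import Data.Fin.Subset.Properties
  using ( _⊆?_; _⊂?_; _∈?_; ∉⊥; Empty-unique; nonempty?; ⊆-refl; ⊆-trans; ⊆-antisym
        ; x∈p∪q⁺; x∈p∪q⁻; x∈p∩q⁺; x∈p∩q⁻; x∈p∧x∉q⇒x∈p─q; p─q⊆p; p⊆p∪q; q⊆p∪q
        ; ∪-identityʳ; ∪-identityˡ; ∪-assoc )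
open import Data.Fin.Subset.Induction using (Acc; acc; ⊂-wellFounded)
open import Data.Vec using ([]; _∷_; here; there)
open import Data.List using (List; []; _∷_; map; length; filterᵇ)
open import Data.List.Properties using (map-cong; filter-≐)
open import Data.List.Relation.Unary.Any using (here; there)
open import Data.List.Relation.Unary.Any.Properties using (any⁺; any⁻)
open import Data.List.Membership.Propositional using (find; lose) renaming (_∈_ to _∈ˡ_)
open import Data.List.Membership.Propositional.Properties
  using (∈-map⁺; ∈-map⁻; ∈-++⁺ˡ; ∈-++⁺ʳ; ∈-++⁻; ∈-filter⁺; ∈-filter⁻)
open import Data.Nat.ListAction using (sum)
open import Data.Product using (∃; ∃₂; _×_; _,_; proj₁; proj₂)
open import Data.Empty using (⊥-elim)
open import Data.Sum using (_⊎_; inj₁; inj₂; [_,_]′)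
open import Function using (id; _∘_; flip; _⇔_; mk⇔; Equivalence)
open import Relation.Binary.PropositionalEquality
  using (_≡_; _≢_; refl; sym; trans; cong; cong₂; subst; module ≡-Reasoning)
open import Relation.Nullary using (Dec; yes; no; ¬_; contradiction)
open import Relation.Nullary.Decidable using (⌊_⌋; T?; isYes≗does; does-⇔)

private variable
  n : ℕ
  x : Fin n
  a b : Bool
  P Q : Set
  p q A B U V X Y Z S : Subset n
  F K H : Family n
  G : Subset n → Set
  L : List (Subset n)

∧-true⁻ : a ∧ b ≡ true → a ≡ true × b ≡ true
∧-true⁻ {true} b≡true = refl , b≡true

∧-true⁺ : a ≡ true → b ≡ true → a ∧ b ≡ true
∧-true⁺ refl refl = refl

isYes-true⁻ : (P? : Dec P) → ⌊ P? ⌋ ≡ true → P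
isYes-true⁻ (yes p) _ = p

isYes-true⁺ : (P? : Dec P) → P → ⌊ P? ⌋ ≡ true
isYes-true⁺ (yes _) _  = refl
isYes-true⁺ (no ¬p) p = contradiction p ¬p

isYes-not⁻ : (P? : Dec P) → not ⌊ P? ⌋ ≡ true → ¬ P
isYes-not⁻ (no ¬p) _ = ¬p

isYes-not⁺ : (P? : Dec P) → ¬ P → not ⌊ P? ⌋ ≡ true
isYes-not⁺ (yes p) ¬p = contradiction p ¬p
isYes-not⁺ (no _)  _  = refl

isYes-⇔ : P ⇔ Q → (P? : Dec P) (Q? : Dec Q) → ⌊ P? ⌋ ≡ ⌊ Q? ⌋
isYes-⇔ P⇔Q P? Q? =
  trans (isYes≗does P?) (trans (does-⇔ P⇔Q P? Q?) (sym (isYes≗does Q?)))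

==⇒≡ : (A == B) ≡ true → A ≡ B
==⇒≡ = isYes-true⁻ (_ ≟ˢ _)

≡⇒== : A ≡ B → (A == B) ≡ true
≡⇒== = isYes-true⁺ (_ ≟ˢ _)

⊆ᵇ⇒⊆ : (A ⊆ᵇ B) ≡ true → A ⊆ B
⊆ᵇ⇒⊆ = isYes-true⁻ (_ ⊆? _)

⊆⇒⊆ᵇ : A ⊆ B → (A ⊆ᵇ B) ≡ true
⊆⇒⊆ᵇ = isYes-true⁺ (_ ⊆? _)

x∈p─q⇒x∉q : ∀ (p q : Subset n) → x ∈ p ─ q → x ∉ q
x∈p─q⇒x∉q (inside ∷ p) (outside ∷ q) here ()
x∈p─q⇒x∉q (_ ∷ p) (_ ∷ q) (there x∈p─q) (there x∈q) = x∈p─q⇒x∉q p q x∈p─q x∈q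

⊆∧≢⇒⊂ : p ⊆ q → p ≢ q → p ⊂ q
⊆∧≢⇒⊂ {p = p} {q} p⊆q p≢q with p ⊂? q
... | yes p⊂q = p⊂q
... | no p⊄q  = contradiction (⊆-antisym p⊆q q⊆p) p≢q
  where
  q⊆p : q ⊆ p
  q⊆p {x} x∈q with x ∈? p
  ... | yes x∈p = x∈p
  ... | no x∉p  = ⊥-elim (p⊄q (p⊆q , x , x∈q , x∉p))

nonempty⇒≢⊥ : Nonempty p → p ≢ ⊥
nonempty⇒≢⊥ (_ , x∈⊥) refl = ∉⊥ x∈⊥

∩≡⊥⇒∉ : p ∩ q ≡ ⊥ → x ∈ p → x ∉ q
∩≡⊥⇒∉ p∩q≡⊥ x∈p x∈q = nonempty⇒≢⊥ (_ , x∈p∩q⁺ (x∈p , x∈q)) p∩q≡⊥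

∉⇒∩≡⊥ : (∀ {x} → x ∈ p → x ∉ q) → p ∩ q ≡ ⊥
∉⇒∩≡⊥ {p = p} {q} disjoint =
  Empty-unique λ (_ , x∈p∩q) → let x∈p , x∈q = x∈p∩q⁻ p q x∈p∩q in disjoint x∈p x∈q

meets⁻ : not ((V ∩ Z) == ⊥) ≡ true → Nonempty (V ∩ Z)
meets⁻ {V = V} {Z} h with nonempty? (V ∩ Z)
... | yes ne = ne
... | no ¬ne = contradiction (Empty-unique ¬ne) (isYes-not⁻ (_ ≟ˢ _) h)

meets⁺ : Nonempty (V ∩ Z) → not ((V ∩ Z) == ⊥) ≡ true
meets⁺ ne = isYes-not⁺ (_ ≟ˢ _) (nonempty⇒≢⊥ ne)

∪∩≡⊥ : p ∩ Z ≡ ⊥ → q ∩ Z ≡ ⊥ → (p ∪ q) ∩ Z ≡ ⊥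
∪∩≡⊥ {p = p} {Z = Z} {q = q} p∩Z≡⊥ q∩Z≡⊥ = ∉⇒∩≡⊥ (avoids ∘ x∈p∪q⁻ p q)
  where
  avoids : x ∈ p ⊎ x ∈ q → x ∉ Z
  avoids (inj₁ x∈p) = ∩≡⊥⇒∉ p∩Z≡⊥ x∈p
  avoids (inj₂ x∈q) = ∩≡⊥⇒∉ q∩Z≡⊥ x∈q

⊆∪-avoiding : V ⊆ X ∪ Z → ¬ Nonempty (V ∩ Z) → V ⊆ X ∪ Y
⊆∪-avoiding {X = X} {Z} V⊆X∪Z ¬V∩Z x∈V with x∈p∪q⁻ X Z (V⊆X∪Z x∈V)
... | inj₁ x∈X = x∈p∪q⁺ (inj₁ x∈X)
... | inj₂ x∈Z = contradiction (_ , x∈p∩q⁺ (x∈V , x∈Z)) ¬V∩Z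

∈─-map : (x ∈ p → x ∈ q) → x ∈ p ─ Z → x ∈ q ─ Z
∈─-map {p = p} {Z = Z} f x∈ = x∈p∧x∉q⇒x∈p─q (f (p─q⊆p p Z x∈)) (x∈p─q⇒x∉q p Z x∈)

any-true⁻ : {C : Set} (f : C → Bool) (xs : List C) →
            any f xs ≡ true → ∃ λ c → c ∈ˡ xs × f c ≡ true
any-true⁻ f xs h =
  let c , c∈xs , fc = find (any⁻ f xs (Equivalence.from T-≡ h))
  in c , c∈xs , Equivalence.to T-≡ fc

any-true⁺ : {C : Set} (f : C → Bool) {xs : List C} {c : C} →
            c ∈ˡ xs → f c ≡ true → any f xs ≡ true
any-true⁺ f c∈xs fc = Equivalence.to T-≡ (any⁺ f (lose c∈xs (Equivalence.from T-≡ fc)))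

∈-subsets : (A : Subset n) → A ∈ˡ subsets n
∈-subsets []            = here refl
∈-subsets (outside ∷ A) = ∈-++⁺ˡ (∈-map⁺ (outside ∷_) (∈-subsets A))
∈-subsets (inside ∷ A)  = ∈-++⁺ʳ _ (∈-map⁺ (inside ∷_) (∈-subsets A))

∈-filterᵇ⁺ : (f : Subset n → Bool) → A ∈ˡ L → f A ≡ true → A ∈ˡ filterᵇ f L
∈-filterᵇ⁺ f A∈L fA = ∈-filter⁺ (T? ∘ f) A∈L (Equivalence.from T-≡ fA)

∈-filterᵇ⁻ : (f : Subset n → Bool) → A ∈ˡ filterᵇ f L → A ∈ˡ L × f A ≡ true
∈-filterᵇ⁻ {L = L} f A∈ = let A∈L , fA = ∈-filter⁻ (T? ∘ f) {xs = L} A∈ in A∈L , Equivalence.to T-≡ fA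

∈-members⁺ : F A ≡ true → A ∈ˡ members F
∈-members⁺ {F = F} {A} = ∈-filterᵇ⁺ F (∈-subsets A)

∈-members⁻ : A ∈ˡ members F → F A ≡ true
∈-members⁻ {F = F} = proj₂ ∘ ∈-filterᵇ⁻ {L = subsets _} F

card-cong : (∀ A → F A ≡ H A) → card F ≡ card H
card-cong {F = F} {H = H} F≗H = cong length (filter-≐ (T? ∘ F) (T? ∘ H) F≐H (subsets _))
  where
  F≐H = (λ {A} → subst T (F≗H A)) , (λ {A} → subst T (sym (F≗H A)))

∈bigUnion⁻ : ∀ (L : List (Subset n)) → x ∈ bigUnion L → ∃ λ A → A ∈ˡ L × x ∈ A
∈bigUnion⁻ [] x∈⊥ = contradiction x∈⊥ ∉⊥
∈bigUnion⁻ (A ∷ L) x∈ with x∈p∪q⁻ A (bigUnion L) x∈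
... | inj₁ x∈A = A , here refl , x∈A
... | inj₂ x∈⋃L = let B , B∈L , x∈B = ∈bigUnion⁻ L x∈⋃L in B , there B∈L , x∈B

∈bigUnion⁺ : A ∈ˡ L → x ∈ A → x ∈ bigUnion L
∈bigUnion⁺ (here refl) x∈A = x∈p∪q⁺ (inj₁ x∈A)
∈bigUnion⁺ (there A∈L) x∈A = x∈p∪q⁺ (inj₂ (∈bigUnion⁺ A∈L x∈A))

bigUnion-closed : UnionClosed K → K ⊥ ≡ true → (L : List (Subset n)) →
                  (∀ {V} → V ∈ˡ L → K V ≡ true) → K (bigUnion L) ≡ true
bigUnion-closed ucK K⊥ []      _   = K⊥
bigUnion-closed ucK K⊥ (V ∷ L) L⊆K =
  ucK V (bigUnion L) (L⊆K (here refl)) (bigUnion-closed ucK K⊥ L (L⊆K ∘ there))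

⊥∈unionsOf : ∀ (L : List (Subset n)) → ⊥ ∈ˡ unionsOf L
⊥∈unionsOf []      = here refl
⊥∈unionsOf (V ∷ L) = ∈-++⁺ˡ (⊥∈unionsOf L)

∈⇒∈unionsOf : V ∈ˡ L → V ∈ˡ unionsOf L
∈⇒∈unionsOf {V = V} {L = _ ∷ L} (here refl) =
  ∈-++⁺ʳ (unionsOf L) (subst (_∈ˡ map (V ∪_) (unionsOf L)) (∪-identityʳ V) (∈-map⁺ (V ∪_) (⊥∈unionsOf L)))
∈⇒∈unionsOf (there V∈L) = ∈-++⁺ˡ (∈⇒∈unionsOf V∈L)

bigUnion-filter∈unionsOf : ∀ (f : Subset n → Bool) L → bigUnion (filterᵇ f L) ∈ˡ unionsOf L
bigUnion-filter∈unionsOf f []      = here refl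
bigUnion-filter∈unionsOf f (V ∷ L) with f V
... | true  = ∈-++⁺ʳ (unionsOf L) (∈-map⁺ (V ∪_) (bigUnion-filter∈unionsOf f L))
... | false = ∈-++⁺ˡ (bigUnion-filter∈unionsOf f L)

∈unionsOf⇒covered : ∀ L → X ∈ˡ unionsOf L → x ∈ X → ∃ λ V → V ∈ˡ L × x ∈ V × V ⊆ X
∈unionsOf⇒covered [] (here refl) x∈⊥ = contradiction x∈⊥ ∉⊥
∈unionsOf⇒covered (V ∷ L) X∈ x∈X with ∈-++⁻ (unionsOf L) X∈
... | inj₁ X∈L =
  let B , B∈L , x∈B , B⊆X = ∈unionsOf⇒covered L X∈L x∈X in B , there B∈L , x∈B , B⊆X
... | inj₂ X∈V∪L with ∈-map⁻ (V ∪_) X∈V∪L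
...   | Y , Y∈L , refl with x∈p∪q⁻ V Y x∈X
...     | inj₁ x∈V = V , here refl , x∈V , p⊆p∪q Y
...     | inj₂ x∈Y =
  let B , B∈L , x∈B , B⊆Y = ∈unionsOf⇒covered L Y∈L x∈Y
  in B , there B∈L , x∈B , q⊆p∪q V Y ∘ B⊆Y

unionsOf-closed : UnionClosed K → K ⊥ ≡ true → ∀ L →
                  (∀ {V} → V ∈ˡ L → K V ≡ true) → X ∈ˡ unionsOf L → K X ≡ true
unionsOf-closed ucK K⊥ [] _ (here refl) = K⊥
unionsOf-closed ucK K⊥ (V ∷ L) L⊆K X∈ with ∈-++⁻ (unionsOf L) X∈
... | inj₁ X∈L = unionsOf-closed ucK K⊥ L (L⊆K ∘ there) X∈L
... | inj₂ X∈V∪L with ∈-map⁻ (V ∪_) X∈V∪L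
...   | Y , Y∈L , refl =
  ucK V Y (L⊆K (here refl)) (unionsOf-closed ucK K⊥ L (L⊆K ∘ there) Y∈L)

∈⋃ᶠ⁻ : x ∈ ⋃ᶠ F → ∃ λ A → F A ≡ true × x ∈ A
∈⋃ᶠ⁻ {F = F} x∈ = let A , A∈ , x∈A = ∈bigUnion⁻ (members F) x∈ in A , ∈-members⁻ A∈ , x∈A

∈⋃ᶠ⁺ : F A ≡ true → x ∈ A → x ∈ ⋃ᶠ F
∈⋃ᶠ⁺ FA = ∈bigUnion⁺ (∈-members⁺ FA)

∈π⁻ : x ∈ π K S → ∃ λ V → K V ≡ true × V ⊆ S × x ∈ V
∈π⁻ {K = K} x∈ =
  let V , KV∧V⊆S , x∈V = ∈⋃ᶠ⁻ {F = λ V → K V ∧ (V ⊆ᵇ _)} x∈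
      KV , V⊆S = ∧-true⁻ KV∧V⊆S
  in V , KV , ⊆ᵇ⇒⊆ V⊆S , x∈V

∈π⁺ : K V ≡ true → V ⊆ S → x ∈ V → x ∈ π K S
∈π⁺ KV V⊆S = ∈⋃ᶠ⁺ (∧-true⁺ KV (⊆⇒⊆ᵇ V⊆S))

π⊆ : π K S ⊆ S
π⊆ x∈ = let _ , _ , V⊆S , x∈V = ∈π⁻ x∈ in V⊆S x∈V

∨ᶠ⁻ : (K ∨ᶠ H) X ≡ true → ∃₂ λ A B → K A ≡ true × H B ≡ true × A ∪ B ≡ X
∨ᶠ⁻ h =
  let A , _ , hA = any-true⁻ _ (subsets _) h
      B , _ , hAB = any-true⁻ _ (subsets _) hA
      KA , rest = ∧-true⁻ hAB
      HB , A∪B==X = ∧-true⁻ rest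
  in A , B , KA , HB , ==⇒≡ A∪B==X

∨ᶠ⁺ : K A ≡ true → H B ≡ true → A ∪ B ≡ X → (K ∨ᶠ H) X ≡ true
∨ᶠ⁺ {A = A} {B = B} KA HB A∪B≡X =
  any-true⁺ _ (∈-subsets A) (any-true⁺ _ (∈-subsets B) (∧-true⁺ KA (∧-true⁺ HB (≡⇒== A∪B≡X))))

avoiding : Family n → Subset n → Family n
avoiding K U Z = K Z ∧ ((Z ∩ U) == ⊥)

avoiding⁻ : avoiding K Y Z ≡ true → K Z ≡ true × Z ∩ Y ≡ ⊥
avoiding⁻ h = let KZ , Z∩Y≡⊥ = ∧-true⁻ h in KZ , ==⇒≡ Z∩Y≡⊥

avoiding⁺ : K Z ≡ true → Z ∩ Y ≡ ⊥ → avoiding K Y Z ≡ true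
avoiding⁺ KZ Z∩Y≡⊥ = ∧-true⁺ KZ (≡⇒== Z∩Y≡⊥)

avoiding-unionClosed : UnionClosed K → UnionClosed (avoiding K Y)
avoiding-unionClosed {K = K} ucK A B hA hB =
  let KA , A∩Y≡⊥ = avoiding⁻ {K = K} hA
      KB , B∩Y≡⊥ = avoiding⁻ {K = K} hB
  in avoiding⁺ {K = K} (ucK A B KA KB) (∪∩≡⊥ A∩Y≡⊥ B∩Y≡⊥)

⋃ᶠ-avoiding∩≡⊥ : ⋃ᶠ (avoiding K Y) ∩ Y ≡ ⊥
⋃ᶠ-avoiding∩≡⊥ {K = K} = ∉⇒∩≡⊥ λ x∈ →
  let Z , hZ , x∈Z = ∈⋃ᶠ⁻ {F = avoiding K _} x∈ in ∩≡⊥⇒∉ (proj₂ (avoiding⁻ {K = K} hZ)) x∈Z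

π-avoiding∩≡⊥ : π (avoiding K Y) S ∩ Y ≡ ⊥
π-avoiding∩≡⊥ {K = K} = ∉⇒∩≡⊥ λ x∈ →
  let Z , hZ , _ , x∈Z = ∈π⁻ {K = avoiding K _} x∈ in ∩≡⊥⇒∉ (proj₂ (avoiding⁻ {K = K} hZ)) x∈Z

π-avoiding∈ : UnionClosed K → K ⊥ ≡ true → K (π (avoiding K Y) S) ≡ true
π-avoiding∈ {K = K} ucK K⊥ = bigUnion-closed ucK K⊥ _ λ V∈ →
  proj₁ (avoiding⁻ {K = K} (proj₁ (∧-true⁻ (∈-members⁻ {F = λ V → avoiding K _ V ∧ (V ⊆ᵇ _)} V∈))))

μ-cong : ∀ {K K′ F′ : Family n} → (∀ X Y → E K U X Y ≡ E K′ U X Y) →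
         μ K F′ U ≡ μ K′ F′ U
μ-cong {U = U} {F′ = F′} E≗E′ =
  cong (λ s → ratio s (card (restrict F′ U)))
       (cong sum (map-cong (λ X → card-cong (λ Y → E≗E′ X Y)) (members (restrict F′ U))))

record Basis (K : Family n) (G : Subset n → Set) : Set where
  field
    basic⇒member : ∀ {V} → G V → K V ≡ true
    covers       : ∀ {A x} → K A ≡ true → x ∈ A → ∃ λ V → G V × x ∈ V × V ⊆ A

module _ {K : Family n} {G : Subset n → Set} (basis : Basis K G) where
  open Basis basis

  ∈π-basis⁻ : x ∈ π K S → ∃ λ V → G V × V ⊆ S × x ∈ V
  ∈π-basis⁻ x∈ =
    let A , KA , A⊆S , x∈A = ∈π⁻ {K = K} x∈
        V , GV , x∈V , V⊆A = covers KA x∈A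
    in V , GV , ⊆-trans V⊆A A⊆S , x∈V

  ∈π-basis⁺ : G V → V ⊆ S → x ∈ V → x ∈ π K S
  ∈π-basis⁺ GV = ∈π⁺ (basic⇒member GV)

  ∈π-basis-split : x ∈ π K (X ∪ Z) →
                   x ∈ π K (X ∪ Y) ⊎ ∃ λ V → G V × Nonempty (V ∩ Z) × x ∈ V
  ∈π-basis-split {Z = Z} x∈ with ∈π-basis⁻ x∈
  ... | V , GV , V⊆X∪Z , x∈V with nonempty? (V ∩ Z)
  ...   | yes ne = inj₂ (V , GV , ne , x∈V)
  ...   | no ¬ne = inj₁ (∈π-basis⁺ GV (⊆∪-avoiding V⊆X∪Z ¬ne) x∈V)

-- Union generators

properSubmembers : Family n → Subset n → Family n
properSubmembers F A B = F B ∧ ((B ⊆ᵇ A) ∧ not (B == A))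

J⇒member : J F V ≡ true → F V ≡ true
J⇒member = proj₁ ∘ ∧-true⁻

generator-below : (F : Family n) → F A ≡ true → x ∈ A → ∃ λ V → J F V ≡ true × x ∈ V × V ⊆ A
generator-below {A = A} F = below A (⊂-wellFounded A)
  where
  below : ∀ A → Acc _⊂_ A → F A ≡ true → x ∈ A → ∃ λ V → J F V ≡ true × x ∈ V × V ⊆ A
  below A (acc smaller) FA x∈A with A ≟ˢ ⋃ᶠ (properSubmembers F A)
  ... | no A≢⋃ =
    A , ∧-true⁺ FA (∧-true⁺ (isYes-not⁺ (_ ≟ˢ _) (nonempty⇒≢⊥ (_ , x∈A)))
                            (isYes-not⁺ (_ ≟ˢ _) A≢⋃)) ,
    x∈A , ⊆-refl
  ... | yes A≡⋃ =
    let B , B-proper , x∈B = ∈⋃ᶠ⁻ {F = properSubmembers F A} (subst (_ ∈_) A≡⋃ x∈A)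
        FB , B⊆A∧B≢A = ∧-true⁻ {a = F B} B-proper
        B⊆A , B≢A = ∧-true⁻ B⊆A∧B≢A
        B⊂A = ⊆∧≢⇒⊂ (⊆ᵇ⇒⊆ B⊆A) (isYes-not⁻ (_ ≟ˢ _) B≢A)
        V , JV , x∈V , V⊆B = below B (smaller B⊂A) FB x∈B
    in V , JV , x∈V , ⊆-trans V⊆B (⊆ᵇ⇒⊆ B⊆A)

generatorBasis : (F : Family n) → Basis F (λ V → J F V ≡ true)
generatorBasis F = record { basic⇒member = J⇒member {F = F} ; covers = generator-below F }

generatorsMeeting : Family n → Subset n → List (Subset n)
generatorsMeeting F Z = members (λ V → J F V ∧ not ((V ∩ Z) == ⊥))

∈generatorsMeeting⁻ : V ∈ˡ generatorsMeeting F Z → J F V ≡ true × Nonempty (V ∩ Z)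
∈generatorsMeeting⁻ {F = F} {Z = Z} V∈ =
  let JV , meets = ∧-true⁻ (∈-members⁻ {F = λ V → J F V ∧ not ((V ∩ Z) == ⊥)} V∈)
  in JV , meets⁻ meets

∈generatorsMeeting⁺ : J F V ≡ true → Nonempty (V ∩ Z) → V ∈ˡ generatorsMeeting F Z
∈generatorsMeeting⁺ JV ne = ∈-members⁺ (∧-true⁺ JV (meets⁺ ne))

𝓝⇒∈unionsOf : 𝓝 F Z X ≡ true → X ∈ˡ unionsOf (generatorsMeeting F Z)
𝓝⇒∈unionsOf {X = X} h =
  let Y , Y∈ , Y==X = any-true⁻ (_== X) _ h in subst (_∈ˡ _) (==⇒≡ Y==X) Y∈

∈unionsOf⇒𝓝 : X ∈ˡ unionsOf (generatorsMeeting F Z) → 𝓝 F Z X ≡ true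
∈unionsOf⇒𝓝 X∈ = any-true⁺ (_== _) X∈ (≡⇒== refl)

generator∈𝓝 : J F V ≡ true → Nonempty (V ∩ Z) → 𝓝 F Z V ≡ true
generator∈𝓝 {F = F} JV ne = ∈unionsOf⇒𝓝 {F = F} (∈⇒∈unionsOf (∈generatorsMeeting⁺ {F = F} JV ne))

𝓝-basis : (F : Family n) (Z : Subset n) → Basis (𝓝 F Z) (λ V → J F V ≡ true × Nonempty (V ∩ Z))
𝓝-basis F Z = record
  { basic⇒member = λ (JV , ne) → generator∈𝓝 {F = F} JV ne
  ; covers       = λ h x∈A →
      let V , V∈ , x∈V , V⊆A = ∈unionsOf⇒covered _ (𝓝⇒∈unionsOf {F = F} h) x∈A
      in V , ∈generatorsMeeting⁻ {F = F} V∈ , x∈V , V⊆A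
  }

𝓝⊆ : UnionClosed F → F ⊥ ≡ true → 𝓝 F Z A ≡ true → F A ≡ true
𝓝⊆ {F = F} ucF F⊥ h =
  unionsOf-closed ucF F⊥ _ (J⇒member {F = F} ∘ proj₁ ∘ ∈generatorsMeeting⁻ {F = F})
                  (𝓝⇒∈unionsOf {F = F} h)

-- The neighbourhood 𝓝³_𝓕(U)

module Neighbourhood {n : ℕ} (F : Family n) (U : Subset n) where

  W : Subset n
  W = ⋃ᶠ (𝓝 F U)

  generator-meeting-U⊆W : J F V ≡ true → Nonempty (V ∩ U) → V ⊆ W
  generator-meeting-U⊆W JV ne = ∈⋃ᶠ⁺ (generator∈𝓝 {F = F} JV ne)

  relevant-or-avoiding : J F V ≡ true → Nonempty (V ∩ W) ⊎ V ∩ U ≡ ⊥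
  relevant-or-avoiding {V = V} JV with nonempty? (V ∩ U)
  ... | no ¬ne = inj₂ (Empty-unique ¬ne)
  ... | yes ne@(y , y∈V∩U) =
    let y∈V = proj₁ (x∈p∩q⁻ V U y∈V∩U)
    in inj₁ (y , x∈p∩q⁺ (y∈V , generator-meeting-U⊆W JV ne y∈V))

  generators : Basis F (λ V → J F V ≡ true)
  generators = generatorBasis F

  relevantGenerators : Basis (𝓝³ F U) (λ V → J F V ≡ true × Nonempty (V ∩ W))
  relevantGenerators = 𝓝-basis F W

  π𝓝³⊆πF : π (𝓝³ F U) S ⊆ π F S
  π𝓝³⊆πF x∈ =
    let V , (JV , _) , V⊆S , x∈V = ∈π-basis⁻ relevantGenerators x∈
    in ∈π-basis⁺ generators JV V⊆S x∈V

  πF⊆π𝓝³-on-W : x ∈ π F S → x ∈ W → x ∈ π (𝓝³ F U) S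
  πF⊆π𝓝³-on-W x∈ x∈W =
    let V , JV , V⊆S , x∈V = ∈π-basis⁻ generators x∈
    in ∈π-basis⁺ relevantGenerators (JV , _ , x∈p∩q⁺ (x∈V , x∈W)) V⊆S x∈V

  π∩U-agree : π F S ∩ U ≡ π (𝓝³ F U) S ∩ U
  π∩U-agree {S = S} = ⊆-antisym F⇒𝓝³ 𝓝³⇒F
    where
    F⇒𝓝³ : π F S ∩ U ⊆ π (𝓝³ F U) S ∩ U
    F⇒𝓝³ x∈ =
      let x∈π , x∈U = x∈p∩q⁻ _ U x∈
          V , JV , _ , x∈V = ∈π-basis⁻ generators x∈π
          x∈W = generator-meeting-U⊆W JV (_ , x∈p∩q⁺ (x∈V , x∈U)) x∈V
      in x∈p∩q⁺ (πF⊆π𝓝³-on-W x∈π x∈W , x∈U)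
    𝓝³⇒F : π (𝓝³ F U) S ∩ U ⊆ π F S ∩ U
    𝓝³⇒F x∈ = let x∈π , x∈U = x∈p∩q⁻ _ U x∈ in x∈p∩q⁺ (π𝓝³⊆πF x∈π , x∈U)

  ∈π-avoiding-or-W : Basis K G → (∀ {V} → G V → J F V ≡ true) →
                     x ∈ π K (X ∪ U) → x ∈ π K (X ∪ Y) ⊎ x ∈ W
  ∈π-avoiding-or-W basis G⇒J x∈ with ∈π-basis-split basis x∈
  ... | inj₁ x∈π = inj₁ x∈π
  ... | inj₂ (V , GV , ne , x∈V) = inj₂ (generator-meeting-U⊆W (G⇒J GV) ne x∈V)

  covered-outside-U-⇔ :
    (π F (X ∪ U) ─ U) ⊆ π F (X ∪ Y) ⇔ (π (𝓝³ F U) (X ∪ U) ─ U) ⊆ π (𝓝³ F U) (X ∪ Y)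
  covered-outside-U-⇔ {X = X} {Y = Y} = mk⇔ F⇒𝓝³ 𝓝³⇒F
    where
    πF πN : Subset n
    πF = π F (X ∪ U)
    πN = π (𝓝³ F U) (X ∪ U)
    F⇒𝓝³ : πF ─ U ⊆ π F (X ∪ Y) → πN ─ U ⊆ π (𝓝³ F U) (X ∪ Y)
    F⇒𝓝³ hF x∈ =
      [ id , πF⊆π𝓝³-on-W (hF (∈─-map {p = πN} {q = πF} π𝓝³⊆πF x∈)) ]′
      (∈π-avoiding-or-W {Y = Y} relevantGenerators proj₁ (p─q⊆p πN U x∈))
    𝓝³⇒F : πN ─ U ⊆ π (𝓝³ F U) (X ∪ Y) → πF ─ U ⊆ π F (X ∪ Y)
    𝓝³⇒F h𝓝³ x∈ =
      [ id , (λ x∈W → π𝓝³⊆πF (h𝓝³ (∈─-map {p = πF} {q = πN} (flip πF⊆π𝓝³-on-W x∈W) x∈))) ]′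
      (∈π-avoiding-or-W {Y = Y} generators id (p─q⊆p πF U x∈))

  E-agree : ∀ X Y → E F U X Y ≡ E (𝓝³ F U) U X Y
  E-agree X Y =
    cong ((Y ⊆ᵇ U) ∧_)
         (cong₂ _∧_ (cong (_== Y) π∩U-agree) (isYes-⇔ covered-outside-U-⇔ (_ ⊆? _) (_ ⊆? _)))

  relevantPart : Subset n → Subset n
  relevantPart A = bigUnion (filterᵇ (_⊆ᵇ A) (generatorsMeeting F W))

  relevantPart∈𝓝³ : 𝓝³ F U (relevantPart A) ≡ true
  relevantPart∈𝓝³ {A = A} =
    ∈unionsOf⇒𝓝 {F = F} (bigUnion-filter∈unionsOf (_⊆ᵇ A) (generatorsMeeting F W))

  member-split : F A ≡ true → relevantPart A ∪ π (avoiding F U) A ≡ A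
  member-split {A = A} FA = ⊆-antisym parts⊆A A⊆parts
    where
    parts⊆A : relevantPart A ∪ π (avoiding F U) A ⊆ A
    parts⊆A x∈ with x∈p∪q⁻ (relevantPart A) _ x∈
    ... | inj₁ x∈rel =
      let V , V∈ , x∈V = ∈bigUnion⁻ _ x∈rel
      in ⊆ᵇ⇒⊆ (proj₂ (∈-filterᵇ⁻ {L = generatorsMeeting F W} (_⊆ᵇ A) V∈)) x∈V
    ... | inj₂ x∈π = π⊆ {K = avoiding F U} x∈π
    A⊆parts : A ⊆ relevantPart A ∪ π (avoiding F U) A
    A⊆parts x∈A with generator-below F FA x∈A
    ... | V , JV , x∈V , V⊆A with relevant-or-avoiding JV
    ...   | inj₁ ne = x∈p∪q⁺ (inj₁
      (∈bigUnion⁺ (∈-filterᵇ⁺ (_⊆ᵇ A) (∈generatorsMeeting⁺ {F = F} JV ne) (⊆⇒⊆ᵇ V⊆A)) x∈V))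
    ...   | inj₂ V∩U≡⊥ = x∈p∪q⁺ (inj₂
      (∈π⁺ {K = avoiding F U} (avoiding⁺ {K = F} (J⇒member {F = F} JV) V∩U≡⊥) V⊆A x∈V))

extension-𝓝³ : ∀ {F F′ : Family n} → UnionClosed F → F ⊥ ≡ true →
               IsExtension F U F′ → IsExtension (𝓝³ F U) U F′
extension-𝓝³ {U = U} {F} {F′} ucF F⊥ (ucF′ , H , (X₀ , HX₀) , _ , ⋃H∩U≡⊥ , F′≗F∨H) =
  ucF′ , avoiding F′ U , (X₀ , H′X₀) , avoiding-unionClosed ucF′ , ⋃ᶠ-avoiding∩≡⊥ {K = F′} ,
  λ X → ⇔→≡ {z = true} (mk⇔ F′⇒𝓝³∨H′ 𝓝³∨H′⇒F′)
  where
  open Neighbourhood F U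

  F∨H⊆F′ : F A ≡ true → H B ≡ true → F′ (A ∪ B) ≡ true
  F∨H⊆F′ FA HB = trans (F′≗F∨H _) (∨ᶠ⁺ {K = F} {H = H} FA HB refl)

  F′⊆F∨H : F′ X ≡ true → ∃₂ λ A B → F A ≡ true × H B ≡ true × A ∪ B ≡ X
  F′⊆F∨H {X = X} F′X = ∨ᶠ⁻ {K = F} {H = H} (trans (sym (F′≗F∨H X)) F′X)

  H-avoiding : H B ≡ true → B ∩ U ≡ ⊥
  H-avoiding HB = ∉⇒∩≡⊥ λ x∈B → ∩≡⊥⇒∉ ⋃H∩U≡⊥ (∈⋃ᶠ⁺ HB x∈B)

  H′X₀ : avoiding F′ U X₀ ≡ true
  H′X₀ = avoiding⁺ {K = F′}
    (subst (λ Z → F′ Z ≡ true) (∪-identityˡ X₀) (F∨H⊆F′ F⊥ HX₀)) (H-avoiding HX₀)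

  F′⇒𝓝³∨H′ : F′ X ≡ true → (𝓝³ F U ∨ᶠ avoiding F′ U) X ≡ true
  F′⇒𝓝³∨H′ {X = X} F′X =
    let A , B , FA , HB , A∪B≡X = F′⊆F∨H F′X
        rest = π (avoiding F U) A ∪ B
        rest∈H′ : avoiding F′ U rest ≡ true
        rest∈H′ = avoiding⁺ {K = F′} (F∨H⊆F′ (π-avoiding∈ ucF F⊥) HB)
                                    (∪∩≡⊥ (π-avoiding∩≡⊥ {K = F}) (H-avoiding HB))
        split : relevantPart A ∪ rest ≡ X
        split = begin
          relevantPart A ∪ (π (avoiding F U) A ∪ B) ≡⟨ ∪-assoc (relevantPart A) _ B ⟨
          (relevantPart A ∪ π (avoiding F U) A) ∪ B ≡⟨ cong (_∪ B) (member-split FA) ⟩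
          A ∪ B                                     ≡⟨ A∪B≡X ⟩
          X                                         ∎
    in ∨ᶠ⁺ {K = 𝓝³ F U} {H = avoiding F′ U} (relevantPart∈𝓝³ {A = A}) rest∈H′ split
    where open ≡-Reasoning

  𝓝³∨H′⇒F′ : (𝓝³ F U ∨ᶠ avoiding F′ U) X ≡ true → F′ X ≡ true
  𝓝³∨H′⇒F′ h =
    let A₁ , Z , 𝓝³A₁ , H′Z , A₁∪Z≡X = ∨ᶠ⁻ {K = 𝓝³ F U} {H = avoiding F′ U} h
        A , B , FA , HB , A∪B≡Z = F′⊆F∨H (proj₁ (avoiding⁻ {K = F′} H′Z))
    in subst (λ X → F′ X ≡ true)
             (trans (∪-assoc A₁ A B) (trans (cong (A₁ ∪_) A∪B≡Z) A₁∪Z≡X))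
             (F∨H⊆F′ (ucF A₁ A (𝓝⊆ ucF F⊥ 𝓝³A₁) FA) HB)

theorem3p12 : (n : ℕ) (F : Family n) → UnionClosed F → F ⊥ ≡ true →
    (U : Subset n) → U ⊆ ⋃ᶠ F → (F' : Family n) → IsExtension F U F' →
    IsExtension (𝓝³ F U) U F' × (μ F F' U ≡ μ (𝓝³ F U) F' U)
theorem3p12 n F ucF F⊥ U _ F' ext =
  extension-𝓝³ ucF F⊥ ext , μ-cong (Neighbourhood.E-agree F U)
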